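{- Let $\mathcal{P}$ be a polytope containing the origin as a vertex. Then for all $k\ge 0$, $s^0_k(\mathcal{P})\le s^1_{k-1}(\mathcal{P})$.
   Context: $s^0_k(\mathcal{P})$ is the number of $k$-dimensional simplex faces of $\mathcal{P}$ containing the origin, and $s^1_k(\mathcal{P})$ the number of $k$-dimensional simplex faces of $\mathcal{P}$ not containing the origin; the empty face counts as a simplex of dimension $-1$ (so $s^1_{ -1}(\mathcal{P})=1$). -}

module Defs where

open import Level using (Level; _⊔_) renaming (suc to lsuc)
open import Data.Nat using (ℕ; zero; suc)
open import Agda.Builtin.Nat as ℕ using ()
open import Data.Fin as Fin using (Fin)
open import Data.Fin.Subset using (Subset; _∈_; _∉_; ∣_∣)
open import Data.Product using (Σ; ∃; _×_; _,_)
open import Data.Sum using (_⊎_)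
open import Relation.Nullary using (¬_)
open import Relation.Binary.Core using (Rel)
open import Relation.Binary.Structures using (IsStrictTotalOrder)
open import Relation.Binary.PropositionalEquality using (_≡_)
open import Algebra.Bundles using (CommutativeRing)

record OrderedField (c ℓ : Level) : Set (lsuc (c ⊔ ℓ)) where
  field
    commutativeRing : CommutativeRing c ℓ
  open CommutativeRing commutativeRing public
  field
    _<_                : Rel Carrier ℓ
    isStrictTotalOrder : IsStrictTotalOrder _≈_ _<_
    +-mono-<           : ∀ {x y} z → x < y → (x + z) < (y + z)
    *-pos              : ∀ {x y} → 0# < x → 0# < y → 0# < (x * y)
    0<1                : 0# < 1#
    inverse            : ∀ x → ¬ (x ≈ 0#) → ∃ λ y → (x * y) ≈ 1#

  _≤_ : Rel Carrier ℓ
  x ≤ y = (x < y) ⊎ (x ≈ y)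

module Geometry {c ℓ : Level} (F : OrderedField c ℓ) where
  open OrderedField F using (Carrier; _≈_; _+_; _*_; 0#; 1#; _≤_)

  Point : ℕ → Set c
  Point d = Fin d → Carrier

  Σᶠ : ∀ {m} → (Fin m → Carrier) → Carrier
  Σᶠ {ℕ.zero}  f = 0#
  Σᶠ {ℕ.suc m} f = f Fin.zero + Σᶠ (λ i → f (Fin.suc i))

  dot : ∀ {d} → Point d → Point d → Carrier
  dot x y = Σᶠ (λ t → x t * y t)

  IsOrigin : ∀ {d} → Point d → Set ℓ
  IsOrigin p = ∀ t → p t ≈ 0#

  IsConvexCombOfOthers : ∀ {d n} → (Fin n → Point d) → Fin n → Set (c ⊔ ℓ)
  IsConvexCombOfOthers V j =
    ∃ λ (λs : Fin _ → Carrier) →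
        (∀ i → 0# ≤ λs i) × (λs j ≈ 0#) × (Σᶠ λs ≈ 1#)
      × (∀ t → Σᶠ (λ i → λs i * V i t) ≈ V j t)

  -- V lists exactly the vertices of the polytope P = conv(V):
  -- no listed point is a convex combination of the others.
  ConvexPosition : ∀ {d n} → (Fin n → Point d) → Set (c ⊔ ℓ)
  ConvexPosition V = ∀ j → ¬ IsConvexCombOfOthers V j

  -- S ⊆ vertices is the vertex set of a face of P = conv(V):
  -- there is a valid inequality  dot a x ≤ b  on P whose equality set
  -- among the vertices is exactly S (empty face: a = 0, b = 1;
  -- P itself: a = 0, b = 0).
  IsFace : ∀ {d n} → (Fin n → Point d) → Subset n → Set (c ⊔ ℓ)
  IsFace {d} V S =
    ∃ λ (a : Point d) → ∃ λ (b : Carrier) →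
        (∀ j → dot a (V j) ≤ b)
      × (∀ j → (j ∈ S → dot a (V j) ≈ b) × (dot a (V j) ≈ b → j ∈ S))

  AffinelyIndependent : ∀ {d n} → (Fin n → Point d) → Subset n → Set (c ⊔ ℓ)
  AffinelyIndependent V S =
    ∀ (λs : Fin _ → Carrier) →
      (∀ j → j ∉ S → λs j ≈ 0#) →
      Σᶠ λs ≈ 0# →
      (∀ t → Σᶠ (λ i → λs i * V i t) ≈ 0#) →
      ∀ j → λs j ≈ 0#

  IsSimplexFace : ∀ {d n} → (Fin n → Point d) → Subset n → Set (c ⊔ ℓ)
  IsSimplexFace V S = IsFace V S × AffinelyIndependent V S

  -- s⁰_k : simplex faces of dimension k containing the origin (vertex o);
  -- k-dimensional simplex has k+1 vertices.
  S⁰ : ∀ {d n} → (Fin n → Point d) → Fin n → ℕ → Subset n → Set (c ⊔ ℓ)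
  S⁰ V o k S = IsSimplexFace V S × o ∈ S × ∣ S ∣ ≡ suc k

  -- s¹_{k-1} : simplex faces of dimension k-1 (k vertices) not containing
  -- the origin (k = 0 gives the empty face, of dimension -1).
  S¹ : ∀ {d n} → (Fin n → Point d) → Fin n → ℕ → Subset n → Set (c ⊔ ℓ)
  S¹ V o k S = IsSimplexFace V S × o ∉ S × ∣ S ∣ ≡ k

-- #{S | P S} ≤ #{S | Q S} for predicates on the finite type Subset n,
-- expressed as: there is a map sending P-sets to Q-sets, injective on P.
_≼_ : ∀ {n p q} → (Subset n → Set p) → (Subset n → Set q) → Set (p ⊔ q)
P ≼ Q = ∃ λ (f : Subset _ → Subset _) → (∀ S → P S → Q (f S)) × (∀ S T → P S → P T → f S ≡ f T → S ≡ T)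

module Submission where

-- Deleting the origin o maps simplex faces containing o injectively to simplex
-- faces with one vertex less avoiding o.  For a simplex face S ∋ o, affine
-- independence and V o = 0 make the V j (j ∈ S ∖ o) linearly independent, so by
-- the Fredholm alternative some linear functional u is 1 on all of them, while
-- u (V o) = 0.  Then u exposes S ∖ o as a face of the face S, and adding u to a
-- large multiple of an inequality defining S exposes S ∖ o as a face of P.

open import Defs
open import Level using (Level; _⊔_)
open import Function using (_∘_)
open import Algebra.Bundles using (CommutativeRing)
open import Data.Nat as ℕ using (ℕ; zero; suc)
import Data.Nat.Properties as ℕ
open import Data.Integer using (+_)
open import Data.Fin as Fin using (Fin; zero; suc)
import Data.Fin.Properties as Fin
open import Data.Fin.Subset using (Subset; _∈_; _∉_; _⊆_; ∣_∣; ⁅_⁆; inside; outside) renaming (_-_ to _∖_)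
open import Data.Fin.Subset.Properties using (_∈?_; p─⊥≡p; p─q⊆p; x∈p∧x≢y⇒x∈p-y; x∈⁅x⁆; x≢y⇒x∉⁅y⁆)
open import Data.Vec using (_∷_; here; there)
import Data.Vec.Properties as Vec
open import Data.Product using (∃; _×_; _,_; proj₁; proj₂)
open import Data.Sum as Sum using (_⊎_; inj₁; inj₂)
open import Relation.Nullary using (¬_; yes; no; contradiction)
open import Relation.Binary.Definitions using (tri<; tri≈; tri>)
open import Relation.Binary.Structures using (IsStrictTotalOrder)
open import Relation.Binary.PropositionalEquality as ≡ using (_≡_; _≢_; cong; cong₂)

-- The ring solver needs a coefficient ring with decidable equality mapping
-- homomorphically into R; ℤ maps into every commutative ring.
module IntegerCoefficientRingSolver {c ℓ : Level} (R : CommutativeRing c ℓ) where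

  open import Data.Integer as ℤ using (ℤ; +_; -[1+_]; _⊖_; sign; _◃_)
  open import Data.Integer.Properties using ([1+m]⊖[1+n]≡m⊖n)
  open import Data.Sign as Sign using (Sign)
  open import Data.Maybe using (just; nothing)
  open import Relation.Binary.Definitions using (WeaklyDecidable)
  open CommutativeRing R
  open import Algebra.Properties.Semiring.Mult.TCOptimised semiring using (×1-homo-*)
  open import Algebra.Properties.Monoid.Mult.TCOptimised +-monoid using (×-homo-+; 1+×) renaming (_×_ to _·_)
  open import Algebra.Properties.AbelianGroup +-abelianGroup using (ε⁻¹≈ε; ⁻¹-∙-comm)
  open import Algebra.Properties.Ring ring using (-‿distribˡ-*; -‿distribʳ-*; -‿involutive)
  open import Algebra.Solver.Ring.AlmostCommutativeRing
  open import Relation.Binary.Reasoning.Setoid setoid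

  ⟦_⟧ℕ : ℕ → Carrier
  ⟦ n ⟧ℕ = n · 1#

  ⟦_⟧ℤ : ℤ → Carrier
  ⟦ + n ⟧ℤ      = ⟦ n ⟧ℕ
  ⟦ -[1+ n ] ⟧ℤ = - ⟦ suc n ⟧ℕ

  ⟦⊖⟧ : ∀ m n → ⟦ m ⊖ n ⟧ℤ ≈ ⟦ m ⟧ℕ - ⟦ n ⟧ℕ
  ⟦⊖⟧ m       zero    = sym (trans (+-congˡ ε⁻¹≈ε) (+-identityʳ _))
  ⟦⊖⟧ zero    (suc n) = sym (+-identityˡ _)
  ⟦⊖⟧ (suc m) (suc n) = begin
    ⟦ suc m ⊖ suc n ⟧ℤ                     ≡⟨ cong ⟦_⟧ℤ ([1+m]⊖[1+n]≡m⊖n m n) ⟩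
    ⟦ m ⊖ n ⟧ℤ                             ≈⟨ ⟦⊖⟧ m n ⟩
    ⟦ m ⟧ℕ - ⟦ n ⟧ℕ                        ≈⟨ [1+a]-[1+b]≈a-b ⟦ m ⟧ℕ ⟦ n ⟧ℕ ⟨
    (1# + ⟦ m ⟧ℕ) - (1# + ⟦ n ⟧ℕ)           ≈⟨ +-cong (1+× m 1#) (-‿cong (1+× n 1#)) ⟨
    ⟦ suc m ⟧ℕ - ⟦ suc n ⟧ℕ                ∎
    where
    [1+a]-[1+b]≈a-b : ∀ a b → (1# + a) - (1# + b) ≈ a - b
    [1+a]-[1+b]≈a-b a b = begin
      (1# + a) + - (1# + b)      ≈⟨ +-congˡ (⁻¹-∙-comm 1# b) ⟨
      (1# + a) + (- 1# + - b)    ≈⟨ +-assoc 1# a _ ⟩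
      1# + (a + (- 1# + - b))    ≈⟨ +-congˡ (+-assoc a _ _) ⟨
      1# + ((a + - 1#) + - b)    ≈⟨ +-congˡ (+-congʳ (+-comm a _)) ⟩
      1# + ((- 1# + a) + - b)    ≈⟨ +-congˡ (+-assoc _ a _) ⟩
      1# + (- 1# + (a + - b))    ≈⟨ +-assoc 1# _ _ ⟨
      (1# + - 1#) + (a + - b)    ≈⟨ +-congʳ (-‿inverseʳ 1#) ⟩
      0# + (a + - b)             ≈⟨ +-identityˡ _ ⟩
      a - b                      ∎

  ⟦+⟧ : ∀ i j → ⟦ i ℤ.+ j ⟧ℤ ≈ ⟦ i ⟧ℤ + ⟦ j ⟧ℤ
  ⟦+⟧ (+ m)    (+ n)    = ×-homo-+ 1# m n
  ⟦+⟧ (+ m)    -[1+ n ] = ⟦⊖⟧ m (suc n)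
  ⟦+⟧ -[1+ m ] (+ n)    = trans (⟦⊖⟧ n (suc m)) (+-comm _ _)
  ⟦+⟧ -[1+ m ] -[1+ n ] = begin
    - ⟦ suc (suc (m ℕ.+ n)) ⟧ℕ      ≡⟨ cong (λ k → - ⟦ suc k ⟧ℕ) (ℕ.+-suc m n) ⟨
    - ⟦ suc m ℕ.+ suc n ⟧ℕ          ≈⟨ -‿cong (×-homo-+ 1# (suc m) (suc n)) ⟩
    - (⟦ suc m ⟧ℕ + ⟦ suc n ⟧ℕ)     ≈⟨ ⁻¹-∙-comm _ _ ⟨
    - ⟦ suc m ⟧ℕ + - ⟦ suc n ⟧ℕ     ∎

  signed : Sign → Carrier → Carrier
  signed Sign.+ x = x
  signed Sign.- x = - x

  signed-cong : ∀ s {x y} → x ≈ y → signed s x ≈ signed s y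
  signed-cong Sign.+ x≈y = x≈y
  signed-cong Sign.- x≈y = -‿cong x≈y

  signed-* : ∀ s t x y → signed (s Sign.* t) (x * y) ≈ signed s x * signed t y
  signed-* Sign.+ Sign.+ x y = refl
  signed-* Sign.+ Sign.- x y = -‿distribʳ-* x y
  signed-* Sign.- Sign.+ x y = -‿distribˡ-* x y
  signed-* Sign.- Sign.- x y = begin
    x * y          ≈⟨ -‿involutive _ ⟨
    - - (x * y)    ≈⟨ -‿cong (-‿distribˡ-* x y) ⟩
    - (- x * y)    ≈⟨ -‿distribʳ-* _ y ⟩
    - x * - y      ∎

  ⟦◃⟧ : ∀ s n → ⟦ s ◃ n ⟧ℤ ≈ signed s ⟦ n ⟧ℕ
  ⟦◃⟧ Sign.+ zero    = refl
  ⟦◃⟧ Sign.- zero    = sym ε⁻¹≈ε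
  ⟦◃⟧ Sign.+ (suc n) = refl
  ⟦◃⟧ Sign.- (suc n) = refl

  ⟦⟧ℤ≈signed : ∀ i → ⟦ i ⟧ℤ ≈ signed (sign i) ⟦ ℤ.∣ i ∣ ⟧ℕ
  ⟦⟧ℤ≈signed (+ n)    = refl
  ⟦⟧ℤ≈signed -[1+ n ] = refl

  ⟦*⟧ : ∀ i j → ⟦ i ℤ.* j ⟧ℤ ≈ ⟦ i ⟧ℤ * ⟦ j ⟧ℤ
  ⟦*⟧ i j = begin
    ⟦ i ℤ.* j ⟧ℤ                                      ≈⟨ ⟦◃⟧ (sign i Sign.* sign j) (ℤ.∣ i ∣ ℕ.* ℤ.∣ j ∣) ⟩
    signed (sign i Sign.* sign j) ⟦ ℤ.∣ i ∣ ℕ.* ℤ.∣ j ∣ ⟧ℕ  ≈⟨ signed-cong (sign i Sign.* sign j) (×1-homo-* ℤ.∣ i ∣ ℤ.∣ j ∣) ⟩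
    signed (sign i Sign.* sign j) (⟦ ℤ.∣ i ∣ ⟧ℕ * ⟦ ℤ.∣ j ∣ ⟧ℕ) ≈⟨ signed-* (sign i) (sign j) _ _ ⟩
    signed (sign i) ⟦ ℤ.∣ i ∣ ⟧ℕ * signed (sign j) ⟦ ℤ.∣ j ∣ ⟧ℕ ≈⟨ *-cong (⟦⟧ℤ≈signed i) (⟦⟧ℤ≈signed j) ⟨
    ⟦ i ⟧ℤ * ⟦ j ⟧ℤ                                   ∎

  ⟦-⟧ : ∀ i → ⟦ ℤ.- i ⟧ℤ ≈ - ⟦ i ⟧ℤ
  ⟦-⟧ (+ zero)    = sym ε⁻¹≈ε
  ⟦-⟧ (+ suc n)   = refl
  ⟦-⟧ -[1+ n ]    = sym (-‿involutive _)

  homomorphism : ℤ.+-*-rawRing -Raw-AlmostCommutative⟶ fromCommutativeRing R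
  homomorphism = record
    { ⟦_⟧ = ⟦_⟧ℤ ; +-homo = ⟦+⟧ ; *-homo = ⟦*⟧ ; -‿homo = ⟦-⟧ ; 0-homo = refl ; 1-homo = refl }

  ≡⇒⟦≈⟧ : WeaklyDecidable (Induced-equivalence homomorphism)
  ≡⇒⟦≈⟧ i j with i ℤ.≟ j
  ... | yes ≡.refl = just refl
  ... | no _       = nothing

  open import Algebra.Solver.Ring ℤ.+-*-rawRing (fromCommutativeRing R) homomorphism ≡⇒⟦≈⟧ public

x∉p∖x : ∀ {n} (p : Subset n) x → x ∉ p ∖ x
x∉p∖x (s ∷ p) zero    ()
x∉p∖x (s ∷ p) (suc x) (there x∈p∖x) = x∉p∖x p x x∈p∖x

x∈p⇒∣p∣≡1+∣p∖x∣ : ∀ {n} {p : Subset n} {x} → x ∈ p → ∣ p ∣ ≡ suc ∣ p ∖ x ∣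
x∈p⇒∣p∣≡1+∣p∖x∣ {p = inside  ∷ p} here      = cong suc (cong ∣_∣ (≡.sym (p─⊥≡p p)))
x∈p⇒∣p∣≡1+∣p∖x∣ {p = inside  ∷ p} (there x∈p) = cong suc (x∈p⇒∣p∣≡1+∣p∖x∣ x∈p)
x∈p⇒∣p∣≡1+∣p∖x∣ {p = outside ∷ p} (there x∈p) = x∈p⇒∣p∣≡1+∣p∖x∣ x∈p

p∖x≡q∖x⇒p≡q : ∀ {n} {p q : Subset n} {x} → x ∈ p → x ∈ q → p ∖ x ≡ q ∖ x → p ≡ q
p∖x≡q∖x⇒p≡q {p = s ∷ p} {t ∷ q} here here eq =
  cong (inside ∷_) (≡.trans (≡.sym (p─⊥≡p p)) (≡.trans (Vec.∷-injectiveʳ eq) (p─⊥≡p q)))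
p∖x≡q∖x⇒p≡q {p = s ∷ p} {t ∷ q} (there x∈p) (there x∈q) eq =
  cong₂ _∷_ (Vec.∷-injectiveˡ eq) (p∖x≡q∖x⇒p≡q x∈p x∈q (Vec.∷-injectiveʳ eq))

module _ {c ℓ : Level} (F : OrderedField c ℓ) where

  open OrderedField F hiding (zero; _<_; _≤_)
  open Geometry F
  open IsStrictTotalOrder isStrictTotalOrder
    using (_≟_; _<?_; compare; irrefl; <-respʳ-≈; <-respˡ-≈)
    renaming (trans to <-trans)
  open import Algebra.Properties.Group +-group using (∙-cancelˡ; ⁻¹-involutive; ⁻¹-injective; ε⁻¹≈ε)
  open IntegerCoefficientRingSolver commutativeRing using (solve; _:=_; _:+_; _:*_; :-_; _:-_; con)
  open import Relation.Binary.Reasoning.Setoid setoid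

  infix 4 _<_ _≤_
  _<_ _≤_ : Carrier → Carrier → Set ℓ
  _<_ = OrderedField._<_ F
  _≤_ = OrderedField._≤_ F

  1≉0 : ¬ 1# ≈ 0#
  1≉0 1≈0 = irrefl (sym 1≈0) 0<1

  x<0⇒0<-x : ∀ {x} → x < 0# → 0# < - x
  x<0⇒0<-x {x} x<0 = <-respʳ-≈ (+-identityˡ (- x)) (<-respˡ-≈ (-‿inverseʳ x) (+-mono-< (- x) x<0))

  +-monoʳ-< : ∀ z {x y} → x < y → z + x < z + y
  +-monoʳ-< z {x} {y} x<y = <-respʳ-≈ (+-comm y z) (<-respˡ-≈ (+-comm x z) (+-mono-< z x<y))

  0<-x⇒x<0 : ∀ {x} → 0# < - x → x < 0#
  0<-x⇒x<0 {x} 0<-x = <-respʳ-≈ (-‿inverseʳ x) (<-respˡ-≈ (+-identityʳ x) (+-monoʳ-< x 0<-x))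

  x-y<0⇒x<y : ∀ {x y} → x - y < 0# → x < y
  x-y<0⇒x<y {x} {y} x-y<0 =
    <-respʳ-≈ (+-identityˡ y) (<-respˡ-≈ (solve 2 (λ x y → (x :- y) :+ y := x) refl x y) (+-mono-< y x-y<0))

  x<y⇒x-y<0 : ∀ {x y} → x < y → x - y < 0#
  x<y⇒x-y<0 {x} {y} x<y = <-respʳ-≈ (-‿inverseʳ y) (+-mono-< (- y) x<y)

  ¬x<0⇒0<x+1 : ∀ {x} → ¬ x < 0# → 0# < x + 1#
  ¬x<0⇒0<x+1 {x} x≮0 with compare 0# x
  ... | tri< 0<x _ _ = <-trans 0<x (<-respˡ-≈ (+-identityʳ x) (+-monoʳ-< x 0<1))
  ... | tri≈ _ 0≈x _ = <-respʳ-≈ (trans (sym (+-identityˡ 1#)) (+-congʳ 0≈x)) 0<1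
  ... | tri> _ _ x<0 = contradiction x<0 x≮0

  pos*neg<0 : ∀ {x y} → 0# < x → y < 0# → x * y < 0#
  pos*neg<0 {x} {y} 0<x y<0 =
    0<-x⇒x<0 (<-respʳ-≈ (solve 2 (λ x y → x :* (:- y) := :- (x :* y)) refl x y) (*-pos 0<x (x<0⇒0<-x y<0)))

  pos*inv-pos : ∀ {x y} → 0# < x → x * y ≈ 1# → 0# < y
  pos*inv-pos {x} {y} 0<x xy≈1 with compare 0# y
  ... | tri< 0<y _ _ = 0<y
  ... | tri≈ _ 0≈y _ = contradiction (trans (sym xy≈1) (trans (*-congˡ (sym 0≈y)) (zeroʳ x))) 1≉0
  ... | tri> _ _ y<0 = contradiction (<-trans 0<1 (<-respˡ-≈ xy≈1 (pos*neg<0 0<x y<0))) (irrefl refl)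

  Σᶠ-cong : ∀ {m} {f g : Fin m → Carrier} → (∀ i → f i ≈ g i) → Σᶠ f ≈ Σᶠ g
  Σᶠ-cong {zero}  f≈g = refl
  Σᶠ-cong {suc m} f≈g = +-cong (f≈g zero) (Σᶠ-cong (f≈g ∘ suc))

  Σᶠ-zero : ∀ {m} {f : Fin m → Carrier} → (∀ i → f i ≈ 0#) → Σᶠ f ≈ 0#
  Σᶠ-zero {zero}  f≈0 = refl
  Σᶠ-zero {suc m} f≈0 = trans (+-cong (f≈0 zero) (Σᶠ-zero (f≈0 ∘ suc))) (+-identityˡ 0#)

  Σᶠ-+ : ∀ {m} (f g : Fin m → Carrier) → Σᶠ (λ i → f i + g i) ≈ Σᶠ f + Σᶠ g
  Σᶠ-+ {zero}  f g = sym (+-identityˡ 0#)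
  Σᶠ-+ {suc m} f g = trans (+-congˡ (Σᶠ-+ (f ∘ suc) (g ∘ suc)))
    (solve 4 (λ a b A B → (a :+ b) :+ (A :+ B) := (a :+ A) :+ (b :+ B)) refl
       (f zero) (g zero) (Σᶠ (f ∘ suc)) (Σᶠ (g ∘ suc)))

  Σᶠ-*ˡ : ∀ {m} x (f : Fin m → Carrier) → Σᶠ (λ i → x * f i) ≈ x * Σᶠ f
  Σᶠ-*ˡ {zero}  x f = sym (zeroʳ x)
  Σᶠ-*ˡ {suc m} x f = trans (+-congˡ (Σᶠ-*ˡ x (f ∘ suc))) (sym (distribˡ x (f zero) (Σᶠ (f ∘ suc))))

  Σᶠ-single : ∀ {m} (o : Fin m) (f : Fin m → Carrier) → (∀ i → i ≢ o → f i ≈ 0#) → Σᶠ f ≈ f o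
  Σᶠ-single zero    f f≈0 = trans (+-congˡ (Σᶠ-zero (λ i → f≈0 (suc i) λ ()))) (+-identityʳ (f zero))
  Σᶠ-single (suc o) f f≈0 =
    trans (+-cong (f≈0 zero λ ()) (Σᶠ-single o (f ∘ suc) (λ i i≢o → f≈0 (suc i) (i≢o ∘ Fin.suc-injective))))
          (+-identityˡ (f (suc o)))

  Σᶠ-*-sub : ∀ {m} (l x r : Fin m → Carrier) z →
             Σᶠ (λ i → l i * (x i - r i * z)) ≈ (- Σᶠ (λ i → l i * r i)) * z + Σᶠ (λ i → l i * x i)
  Σᶠ-*-sub {zero}  l x r z = solve 1 (λ z → con (+ 0) := (:- con (+ 0)) :* z :+ con (+ 0)) refl z
  Σᶠ-*-sub {suc m} l x r z = trans (+-congˡ (Σᶠ-*-sub (l ∘ suc) (x ∘ suc) (r ∘ suc) z))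
    (solve 6 (λ l₀ x₀ r₀ z R S → l₀ :* (x₀ :- r₀ :* z) :+ ((:- R) :* z :+ S)
                               := (:- (l₀ :* r₀ :+ R)) :* z :+ (l₀ :* x₀ :+ S)) refl
       (l zero) (x zero) (r zero) z (Σᶠ (λ i → l (suc i) * r (suc i))) (Σᶠ (λ i → l (suc i) * x (suc i))))

  dot-congʳ : ∀ {d} (a : Point d) {x y : Point d} → (∀ t → x t ≈ y t) → dot a x ≈ dot a y
  dot-congʳ a x≈y = Σᶠ-cong (λ t → *-congˡ (x≈y t))

  dot-originʳ : ∀ {d} (a : Point d) {x : Point d} → IsOrigin x → dot a x ≈ 0#
  dot-originʳ a x≈0 = Σᶠ-zero (λ t → trans (*-congˡ (x≈0 t)) (zeroʳ _))

  dot-+ˡ : ∀ {d} (a b x : Point d) → dot (λ t → a t + b t) x ≈ dot a x + dot b x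
  dot-+ˡ a b x = trans (Σᶠ-cong (λ t → distribʳ (x t) (a t) (b t))) (Σᶠ-+ (λ t → a t * x t) (λ t → b t * x t))

  dot-*ˡ : ∀ {d} r (a x : Point d) → dot (λ t → r * a t) x ≈ r * dot a x
  dot-*ˡ r a x = trans (Σᶠ-cong (λ t → *-assoc r (a t) (x t))) (Σᶠ-*ˡ r (λ t → a t * x t))

  dot-+*ʳ : ∀ {d} (a x y : Point d) r → dot a (λ t → x t + r * y t) ≈ dot a x + r * dot a y
  dot-+*ʳ a x y r =
    trans (Σᶠ-cong (λ t → solve 4 (λ A X Y R → A :* (X :+ R :* Y) := A :* X :+ R :* (A :* Y)) refl (a t) (x t) (y t) r))
          (trans (Σᶠ-+ (λ t → a t * x t) (λ t → r * (a t * y t))) (+-congˡ (Σᶠ-*ˡ r (λ t → a t * y t))))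

  unit : ∀ {d} → Fin d → Point d
  unit zero    zero    = 1#
  unit zero    (suc s) = 0#
  unit (suc t) zero    = 0#
  unit (suc t) (suc s) = unit t s

  dot-unitˡ : ∀ {d} (t : Fin d) (x : Point d) → dot (unit t) x ≈ x t
  dot-unitˡ zero    x = trans (+-cong (*-identityˡ (x zero)) (Σᶠ-zero (λ s → zeroˡ (x (suc s))))) (+-identityʳ (x zero))
  dot-unitˡ (suc t) x = trans (+-cong (zeroˡ (x zero)) (dot-unitˡ t (x ∘ suc))) (+-identityˡ _)

  origin⊎pivot : ∀ {d} (x : Point d) → IsOrigin x ⊎ ∃ λ t → ¬ x t ≈ 0#
  origin⊎pivot {zero}  x = inj₁ λ ()
  origin⊎pivot {suc d} x with x zero ≟ 0# | origin⊎pivot (x ∘ suc)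
  ... | no x₀≉0  | _                = inj₂ (zero , x₀≉0)
  ... | yes _    | inj₂ (t , xₜ≉0)   = inj₂ (suc t , xₜ≉0)
  ... | yes x₀≈0 | inj₁ x∘suc≈0      = inj₁ λ { zero → x₀≈0 ; (suc t) → x∘suc≈0 t }

  Solvable : ∀ {m d} → (Fin m → Point d) → (Fin m → Carrier) → Set (c ⊔ ℓ)
  Solvable {d = d} v b = ∃ λ (a : Point d) → ∀ i → dot a (v i) ≈ b i

  Inconsistent : ∀ {m d} → (Fin m → Point d) → (Fin m → Carrier) → Set (c ⊔ ℓ)
  Inconsistent {m} v b =
    ∃ λ (l : Fin m → Carrier) → (∀ t → Σᶠ (λ i → l i * v i t) ≈ 0#) × ¬ Σᶠ (λ i → l i * b i) ≈ 0#

  module PivotElimination {m d} (v : Fin (suc m) → Point d) (b : Fin (suc m) → Carrier)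
                          (t : Fin d) (y : Carrier) (pivot : v zero t * y ≈ 1#) where

    r : Fin m → Carrier
    r i = v (suc i) t * y

    v′ : Fin m → Point d
    v′ i s = v (suc i) s - r i * v zero s

    b′ : Fin m → Carrier
    b′ i = b (suc i) - r i * b zero

    v′-pivot : ∀ i → v′ i t ≈ 0#
    v′-pivot i = begin
      v (suc i) t - (v (suc i) t * y) * v zero t  ≈⟨ solve 3 (λ w y p → w :- (w :* y) :* p := w :- w :* (p :* y))
                                                          refl (v (suc i) t) y (v zero t) ⟩
      v (suc i) t - v (suc i) t * (v zero t * y)  ≈⟨ +-congˡ (-‿cong (*-congˡ pivot)) ⟩
      v (suc i) t - v (suc i) t * 1#              ≈⟨ solve 1 (λ w → w :- w :* con (+ 1) := con (+ 0)) refl (v (suc i) t) ⟩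
      0#                                          ∎

    solvable : Solvable v′ b′ → Solvable v b
    solvable (a′ , a′-solves) = a , a-solves
      where
      μ = (b zero - dot a′ (v zero)) * y
      a : Point d
      a s = a′ s + μ * unit t s
      dot-a : ∀ x → dot a x ≈ dot a′ x + μ * x t
      dot-a x = trans (dot-+ˡ a′ (λ s → μ * unit t s) x) (+-congˡ (trans (dot-*ˡ μ (unit t) x) (*-congˡ (dot-unitˡ t x))))
      a-solves₀ : dot a (v zero) ≈ b zero
      a-solves₀ = begin
        dot a (v zero)                  ≈⟨ dot-a (v zero) ⟩
        P + (b zero - P) * y * v zero t ≈⟨ solve 4 (λ P b₀ y p → P :+ (b₀ :- P) :* y :* p := P :+ (b₀ :- P) :* (p :* y))
                                                    refl P (b zero) y (v zero t) ⟩
        P + (b zero - P) * (v zero t * y) ≈⟨ +-congˡ (*-congˡ pivot) ⟩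
        P + (b zero - P) * 1#           ≈⟨ solve 2 (λ P b₀ → P :+ (b₀ :- P) :* con (+ 1) := b₀) refl P (b zero) ⟩
        b zero                          ∎
        where P = dot a′ (v zero)
      a-solves : ∀ i → dot a (v i) ≈ b i
      a-solves zero    = a-solves₀
      a-solves (suc i) = begin
        dot a (v (suc i))                         ≈⟨ dot-congʳ a (λ s → solve 3 (λ x r z → x := (x :- r :* z) :+ r :* z)
                                                                                 refl (v (suc i) s) (r i) (v zero s)) ⟩
        dot a (λ s → v′ i s + r i * v zero s)     ≈⟨ dot-+*ʳ a (v′ i) (v zero) (r i) ⟩
        dot a (v′ i) + r i * dot a (v zero)       ≈⟨ +-cong (dot-a (v′ i)) (*-congˡ a-solves₀) ⟩
        (dot a′ (v′ i) + μ * v′ i t) + r i * b zero ≈⟨ +-congʳ (+-cong (a′-solves i) (*-congˡ (v′-pivot i))) ⟩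
        (b′ i + μ * 0#) + r i * b zero             ≈⟨ solve 4 (λ bᵢ r b₀ μ → (bᵢ :- r :* b₀ :+ μ :* con (+ 0)) :+ r :* b₀ := bᵢ)
                                                              refl (b (suc i)) (r i) (b zero) μ ⟩
        b (suc i)                                 ∎

    inconsistent : Inconsistent v′ b′ → Inconsistent v b
    inconsistent (l , l-kills-v′ , l-detects-b′) = l⁺ , l⁺-kills-v , l⁺-detects-b
      where
      l⁺ : Fin (suc m) → Carrier
      l⁺ zero    = - Σᶠ (λ i → l i * r i)
      l⁺ (suc i) = l i
      l⁺-kills-v : ∀ s → Σᶠ (λ i → l⁺ i * v i s) ≈ 0#
      l⁺-kills-v s = trans (sym (Σᶠ-*-sub l (λ i → v (suc i) s) r (v zero s))) (l-kills-v′ s)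
      l⁺-detects-b : ¬ Σᶠ (λ i → l⁺ i * b i) ≈ 0#
      l⁺-detects-b eq = l-detects-b′ (trans (Σᶠ-*-sub l (b ∘ suc) r (b zero)) eq)

  fredholm-alternative : ∀ {m d} (v : Fin m → Point d) (b : Fin m → Carrier) → Solvable v b ⊎ Inconsistent v b
  fredholm-alternative {zero} v b = inj₁ ((λ _ → 0#) , λ ())
  fredholm-alternative {suc m} v b with origin⊎pivot (v zero)
  ... | inj₂ (t , vₜ≉0) with inverse (v zero t) vₜ≉0
  ...   | y , pivot = Sum.map solvable inconsistent (fredholm-alternative v′ b′)
    where open PivotElimination v b t y pivot
  fredholm-alternative {suc m} v b | inj₁ v₀≈0 with b zero ≟ 0# | fredholm-alternative (v ∘ suc) (b ∘ suc)
  ... | no b₀≉0 | _ = inj₂ (unit zero , (λ s → trans (dot-unitˡ zero (λ i → v i s)) (v₀≈0 s)) ,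
                                      λ eq → b₀≉0 (trans (sym (dot-unitˡ zero b)) eq))
  ... | yes b₀≈0 | inj₁ (a , a-solves) = inj₁ (a , λ { zero → trans (dot-originʳ a v₀≈0) (sym b₀≈0) ; (suc i) → a-solves i })
  ... | yes _    | inj₂ (l , l-kills-v , l-detects-b) = inj₂ (l⁺ , l⁺-kills-v , l⁺-detects-b)
    where
    l⁺ : Fin (suc m) → Carrier
    l⁺ zero    = 0#
    l⁺ (suc i) = l i
    l⁺-kills-v : ∀ s → Σᶠ (λ i → l⁺ i * v i s) ≈ 0#
    l⁺-kills-v s = trans (+-cong (zeroˡ (v zero s)) (l-kills-v s)) (+-identityˡ 0#)
    l⁺-detects-b : ¬ Σᶠ (λ i → l⁺ i * b i) ≈ 0#
    l⁺-detects-b eq = l-detects-b (trans (sym (+-identityˡ _)) (trans (+-congʳ (sym (zeroˡ (b zero)))) eq))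

  ∃M*A+U<0 : ∀ {m} (A U : Fin m → Carrier) → ∃ λ M → ∀ j → A j < 0# → M * A j + U j < 0#
  ∃M*A+U<0 {zero}  A U = 0# , λ ()
  ∃M*A+U<0 {suc m} A U with ∃M*A+U<0 (A ∘ suc) (U ∘ suc) | A zero <? 0#
  ... | M , M-works | no A₀≮0 = M , λ { zero A₀<0 → contradiction A₀<0 A₀≮0 ; (suc j) → M-works j }
  ... | M , M-works | yes A₀<0 with M * A zero + U zero <? 0#
  ...   | yes X<0 = M , λ { zero _ → X<0 ; (suc j) → M-works j }
  ...   | no X≮0  = M + δ , λ { zero _ → works₀ ; (suc j) Aⱼ<0 → <-trans (shifted j Aⱼ<0) (M-works j Aⱼ<0) }
    where
    X = M * A zero + U zero
    0<-A₀ = x<0⇒0<-x A₀<0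
    -A₀⁻¹ = inverse (- A zero) (λ -A₀≈0 → irrefl (sym -A₀≈0) 0<-A₀)
    ι = proj₁ -A₀⁻¹
    -A₀*ι≈1 = proj₂ -A₀⁻¹
    δ = (X + 1#) * ι
    0<δ : 0# < δ
    0<δ = *-pos (¬x<0⇒0<x+1 X≮0) (pos*inv-pos 0<-A₀ -A₀*ι≈1)
    -- δ is chosen so that (M + δ) * A zero + U zero = -1
    works₀ : (M + δ) * A zero + U zero < 0#
    works₀ = <-respˡ-≈ (sym (begin
      (M + (X + 1#) * ι) * A zero + U zero ≈⟨ solve 4 (λ M A U ι → (M :+ (M :* A :+ U :+ con (+ 1)) :* ι) :* A :+ U
                                             := (M :* A :+ U) :- (M :* A :+ U :+ con (+ 1)) :* ((:- A) :* ι)) refl M (A zero) (U zero) ι ⟩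
      X - (X + 1#) * (- A zero * ι)        ≈⟨ +-congˡ (-‿cong (*-congˡ -A₀*ι≈1)) ⟩
      X - (X + 1#) * 1#                    ≈⟨ solve 1 (λ X → X :- (X :+ con (+ 1)) :* con (+ 1) := :- con (+ 1)) refl X ⟩
      - 1#                                 ∎))
      (0<-x⇒x<0 (<-respʳ-≈ (sym (⁻¹-involutive 1#)) 0<1))
    shifted : ∀ j → A (suc j) < 0# → (M + δ) * A (suc j) + U (suc j) < M * A (suc j) + U (suc j)
    shifted j Aⱼ<0 = <-respˡ-≈ (solve 4 (λ M δ A U → (M :* A :+ U) :+ δ :* A := (M :+ δ) :* A :+ U) refl M δ (A (suc j)) (U (suc j)))
      (<-respʳ-≈ (+-identityʳ _) (+-monoʳ-< (M * A (suc j) + U (suc j)) (pos*neg<0 0<δ Aⱼ<0)))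

  face-of-face : ∀ {d n} {V : Fin n → Point d} {S T : Subset n} → IsFace V S →
                 (u : Point d) (β : Carrier) →
                 (∀ j → j ∈ S → dot u (V j) ≤ β) →
                 (∀ j → j ∈ T → j ∈ S × dot u (V j) ≈ β) →
                 (∀ j → j ∈ S → dot u (V j) ≈ β → j ∈ T) →
                 IsFace V T
  face-of-face {V = V} {S} {T} (a , b , a-valid , a-exposes) u β u-valid u-on-T u-exposes =
    a′ , b′ , valid , λ j → exposes₁ j , exposes₂ j
    where
    A U : Fin _ → Carrier
    A j = dot a (V j) - b
    U j = dot u (V j) - β
    M = proj₁ (∃M*A+U<0 A U)
    a′ : Point _
    a′ t = M * a t + u t
    b′ = M * b + β
    dot-a′ : ∀ j → dot a′ (V j) ≈ M * dot a (V j) + dot u (V j)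
    dot-a′ j = trans (dot-+ˡ (λ t → M * a t) u (V j)) (+-congʳ (dot-*ˡ M a (V j)))
    on-S : ∀ j → j ∈ S → dot a′ (V j) ≈ M * b + dot u (V j)
    on-S j j∈S = trans (dot-a′ j) (+-congʳ (*-congˡ (proj₁ (a-exposes j) j∈S)))
    off-S : ∀ j → j ∉ S → dot a′ (V j) < b′
    off-S j j∉S = x-y<0⇒x<y (<-respˡ-≈ (sym gap) (proj₂ (∃M*A+U<0 A U) j (x<y⇒x-y<0 a·Vⱼ<b)))
      where
      gap : dot a′ (V j) - b′ ≈ M * A j + U j
      gap = trans (+-congʳ (dot-a′ j))
        (solve 5 (λ M x b y β → M :* x :+ y :- (M :* b :+ β) := M :* (x :- b) :+ (y :- β))
               refl M (dot a (V j)) b (dot u (V j)) β)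
      a·Vⱼ<b : dot a (V j) < b
      a·Vⱼ<b with a-valid j
      ... | inj₁ lt = lt
      ... | inj₂ eq = contradiction (proj₂ (a-exposes j) eq) j∉S
    valid : ∀ j → dot a′ (V j) ≤ b′
    valid j with j ∈? S
    ... | no j∉S = inj₁ (off-S j j∉S)
    ... | yes j∈S with u-valid j j∈S
    ...   | inj₁ lt = inj₁ (<-respˡ-≈ (sym (on-S j j∈S)) (+-monoʳ-< (M * b) lt))
    ...   | inj₂ eq = inj₂ (trans (on-S j j∈S) (+-congˡ eq))
    exposes₁ : ∀ j → j ∈ T → dot a′ (V j) ≈ b′
    exposes₁ j j∈T = trans (on-S j (proj₁ (u-on-T j j∈T))) (+-congˡ (proj₂ (u-on-T j j∈T)))
    exposes₂ : ∀ j → dot a′ (V j) ≈ b′ → j ∈ T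
    exposes₂ j eq with j ∈? S
    ... | no j∉S = contradiction (<-respˡ-≈ eq (off-S j j∉S)) (irrefl refl)
    ... | yes j∈S = u-exposes j j∈S (∙-cancelˡ (M * b) _ _ (trans (sym (on-S j j∈S)) eq))

  indicator : ∀ {n} → Subset n → Fin n → Carrier
  indicator p j with j ∈? p
  ... | yes _ = 1#
  ... | no _  = 0#

  indicator-∈ : ∀ {n} {p : Subset n} {j} → j ∈ p → indicator p j ≈ 1#
  indicator-∈ {p = p} {j} j∈p with j ∈? p
  ... | yes _   = refl
  ... | no j∉p = contradiction j∈p j∉p

  indicator-∉ : ∀ {n} {p : Subset n} {j} → j ∉ p → indicator p j ≈ 0#
  indicator-∉ {p = p} {j} j∉p with j ∈? p
  ... | yes j∈p = contradiction j∈p j∉p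
  ... | no _    = refl

  Σᶠ-indicator⁅⁆ : ∀ {n} (o : Fin n) (x : Fin n → Carrier) → Σᶠ (λ j → indicator ⁅ o ⁆ j * x j) ≈ x o
  Σᶠ-indicator⁅⁆ o x = trans (Σᶠ-single o _ (λ j j≢o → trans (*-congʳ (indicator-∉ (x≢y⇒x∉⁅y⁆ j≢o))) (zeroˡ (x j))))
                             (trans (*-congʳ (indicator-∈ (x∈⁅x⁆ o))) (*-identityˡ (x o)))

  affinelyIndependent-⊆ : ∀ {d n} {V : Fin n → Point d} {S T : Subset n} → T ⊆ S →
                          AffinelyIndependent V S → AffinelyIndependent V T
  affinelyIndependent-⊆ T⊆S indep λs λs-supported = indep λs (λ j j∉S → λs-supported j (j∉S ∘ T⊆S))

  module _ {d n} {V : Fin n → Point d} {o : Fin n} (origin : IsOrigin (V o)) where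

    module _ {S : Subset n} (o∈S : o ∈ S) (indep : AffinelyIndependent V S) where

      -- Row j of the system u · (ι j V j) = ι j is u · V j = 1 for j ∈ S ∖ o and trivial otherwise.
      private
        ι : Fin n → Carrier
        ι = indicator (S ∖ o)

      -- An inconsistency l, corrected by -Σ l ι at the origin, is an affine dependence on S.
      dual-system-consistent : ¬ Inconsistent (λ j t → ι j * V j t) ι
      dual-system-consistent (l , l-kills , l-detects) = l-detects X≈0
        where
        X = Σᶠ (λ j → l j * ι j)
        μ : Fin n → Carrier
        μ j = l j * ι j + indicator ⁅ o ⁆ j * - X
        μ-supported : ∀ j → j ∉ S → μ j ≈ 0#
        μ-supported j j∉S = trans (+-cong (trans (*-congˡ (indicator-∉ (j∉S ∘ p─q⊆p S ⁅ o ⁆))) (zeroʳ (l j)))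
                                           (trans (*-congʳ (indicator-∉ (x≢y⇒x∉⁅y⁆ j≢o))) (zeroˡ (- X))))
                                   (+-identityˡ 0#)
          where j≢o = λ j≡o → j∉S (≡.subst (_∈ S) (≡.sym j≡o) o∈S)
        Σμ≈0 : Σᶠ μ ≈ 0#
        Σμ≈0 = begin
          Σᶠ μ                                              ≈⟨ Σᶠ-+ (λ j → l j * ι j) (λ j → indicator ⁅ o ⁆ j * - X) ⟩
          X + Σᶠ (λ j → indicator ⁅ o ⁆ j * - X)            ≈⟨ +-congˡ (Σᶠ-indicator⁅⁆ o (λ _ → - X)) ⟩
          X - X                                             ≈⟨ -‿inverseʳ X ⟩
          0#                                                ∎
        μ-kills : ∀ t → Σᶠ (λ j → μ j * V j t) ≈ 0#
        μ-kills t = begin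
          Σᶠ (λ j → μ j * V j t)
            ≈⟨ Σᶠ-cong (λ j → solve 5 (λ l ι k X x → (l :* ι :+ k :* (:- X)) :* x := l :* (ι :* x) :+ k :* ((:- X) :* x))
                                       refl (l j) (ι j) (indicator ⁅ o ⁆ j) X (V j t)) ⟩
          Σᶠ (λ j → l j * (ι j * V j t) + indicator ⁅ o ⁆ j * (- X * V j t))
            ≈⟨ Σᶠ-+ (λ j → l j * (ι j * V j t)) (λ j → indicator ⁅ o ⁆ j * (- X * V j t)) ⟩
          Σᶠ (λ j → l j * (ι j * V j t)) + Σᶠ (λ j → indicator ⁅ o ⁆ j * (- X * V j t))
            ≈⟨ +-cong (l-kills t) (Σᶠ-indicator⁅⁆ o (λ j → - X * V j t)) ⟩
          0# + - X * V o t
            ≈⟨ trans (+-identityˡ _) (trans (*-congˡ (origin t)) (zeroʳ (- X))) ⟩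
          0#  ∎
        X≈0 : X ≈ 0#
        X≈0 = ⁻¹-injective (begin
          - X            ≈⟨ trans (+-identityˡ _) (*-identityˡ (- X)) ⟨
          0# + 1# * - X  ≈⟨ +-cong (trans (*-congˡ (indicator-∉ (x∉p∖x S o))) (zeroʳ (l o))) (*-congʳ (indicator-∈ (x∈⁅x⁆ o))) ⟨
          μ o            ≈⟨ indep μ μ-supported Σμ≈0 μ-kills o ⟩
          0#             ≈⟨ ε⁻¹≈ε ⟨
          - 0#           ∎)

      ∃-dual-functional : ∃ λ (u : Point d) → ∀ j → j ∈ S ∖ o → dot u (V j) ≈ 1#
      ∃-dual-functional with fredholm-alternative (λ j t → ι j * V j t) ι
      ... | inj₂ inconsistent       = contradiction inconsistent dual-system-consistent
      ... | inj₁ (u , u-solves) = u , λ j j∈S∖o → begin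
        dot u (V j)                ≈⟨ dot-congʳ u (λ t → trans (*-congʳ (indicator-∈ j∈S∖o)) (*-identityˡ (V j t))) ⟨
        dot u (λ t → ι j * V j t)  ≈⟨ u-solves j ⟩
        ι j                        ≈⟨ indicator-∈ j∈S∖o ⟩
        1#                         ∎

    face∖origin : ∀ {S} → o ∈ S → IsSimplexFace V S → IsFace V (S ∖ o)
    face∖origin {S} o∈S (face , indep) = face-of-face face u 1# u·V≤1 on-S∖o exposes
      where
      u = proj₁ (∃-dual-functional o∈S indep)
      u·V≈1 = proj₂ (∃-dual-functional o∈S indep)
      u·Vₒ≈0 : dot u (V o) ≈ 0#
      u·Vₒ≈0 = dot-originʳ u origin
      u·V≤1 : ∀ j → j ∈ S → dot u (V j) ≤ 1#
      u·V≤1 j j∈S with j Fin.≟ o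
      ... | yes ≡.refl = inj₁ (<-respˡ-≈ (sym u·Vₒ≈0) 0<1)
      ... | no j≢o     = inj₂ (u·V≈1 j (x∈p∧x≢y⇒x∈p-y j∈S j≢o))
      on-S∖o : ∀ j → j ∈ S ∖ o → j ∈ S × dot u (V j) ≈ 1#
      on-S∖o j j∈S∖o = p─q⊆p S ⁅ o ⁆ j∈S∖o , u·V≈1 j j∈S∖o
      exposes : ∀ j → j ∈ S → dot u (V j) ≈ 1# → j ∈ S ∖ o
      exposes j j∈S u·Vⱼ≈1 with j Fin.≟ o
      ... | yes ≡.refl = contradiction (trans (sym u·Vⱼ≈1) u·Vₒ≈0) 1≉0
      ... | no j≢o     = x∈p∧x≢y⇒x∈p-y j∈S j≢o

    simplexFace∖origin : ∀ {S} → o ∈ S → IsSimplexFace V S → IsSimplexFace V (S ∖ o)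
    simplexFace∖origin {S} o∈S σ = face∖origin o∈S σ , affinelyIndependent-⊆ (p─q⊆p S ⁅ o ⁆) (proj₂ σ)

proposition3p6 : ∀ {c ℓ : Level} (F : OrderedField c ℓ) {d n : ℕ}
                   (V : Fin n → Geometry.Point F d) →
                   Geometry.ConvexPosition F V →
                   (o : Fin n) → Geometry.IsOrigin F (V o) →
                   (k : ℕ) → Geometry.S⁰ F V o k ≼ Geometry.S¹ F V o k
proposition3p6 F V _ o origin k = (_∖ o) , S⁰⇒S¹ , λ S T (_ , o∈S , _) (_ , o∈T , _) → p∖x≡q∖x⇒p≡q o∈S o∈T
  where
  S⁰⇒S¹ : ∀ S → Geometry.S⁰ F V o k S → Geometry.S¹ F V o k (S ∖ o)
  S⁰⇒S¹ S (σ , o∈S , ∣S∣≡1+k) =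
    simplexFace∖origin F {V = V} origin o∈S σ , x∉p∖x S o ,
    ℕ.suc-injective (≡.trans (≡.sym (x∈p⇒∣p∣≡1+∣p∖x∣ o∈S)) ∣S∣≡1+k)
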